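{- Let $s\ge g\ge 3$ with $s>(g-1)^2$, and let $V$ be the set of treatments of a pseudo-$L_g(s)$ association scheme. Suppose that for every treatment $t\in V$ there are chosen pairwise disjoint sets $A^t_1,\dots,A^t_g$, each of cardinality $s-1$, whose union is the set of first associates of $t$, such that each $\{t\}\cup A^t_i$ is a clique, and such that for every $i$, every $a\in A^t_i$ and every $j\neq i$, exactly $g-2$ treatments of $A^t_j$ are first associates of $a$. Then: (1) for every $t$, every $i$ and every $a\in A^t_i$, the only clique of cardinality $s$ containing $t$ and $a$ is $\{t\}\cup A^t_i$; (2) for any two distinct first associates $t_1,t_2$, writing $A^1_i=A^{t_1}_i$, $A^2_j=A^{t_2}_j$, and letting $i_1,j_1$ be the indices with $t_2\in A^1_{i_1}$ and $t_1\in A^2_{j_1}$: (a) $\{t_1\}\cup A^1_{i_1}=\{t_2\}\cup A^2_{j_1}$, and this is the unique clique of cardinality $s$ containing $t_1$ and $t_2$; (b) for every $i_2\neq i_1$ there is exactly one $j_2\neq j_1$ with $(\{t_1\}\cup A^1_{i_2})\cap(\{t_2\}\cup A^2_{j_2})=\emptyset$, and for every $j'\notin\{j_1,j_2\}$ the intersection $(\{t_1\}\cup A^1_{i_2})\cap(\{t_2\}\cup A^2_{j'})$ consists of a single treatment, which is a first associate of both $t_1$ and $t_2$; (c) for every $j_3\neq j_1$ there is exactly one $i_3\neq i_1$ with $(\{t_2\}\cup A^2_{j_3})\cap(\{t_1\}\cup A^1_{i_3})=\emptyset$, and for every $i'\notin\{i_1,i_3\}$ the intersection $(\{t_2\}\cup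 A^2_{j_3})\cap(\{t_1\}\cup A^1_{i'})$ consists of a single treatment, which is a first associate of both $t_1$ and $t_2$.
   Context: An association scheme with two associate classes on $v$ treatments is a symmetric relation splitting every pair of distinct treatments into first or second associates such that each treatment has $n_i$ $i$-th associates and for two $i$-th associates the number of treatments that are $j$-th associates of the first and $k$-th associates of the second is a constant $p^i_{jk}$. A pseudo-$L_g(s)$ association scheme has $v=s^2$, $n_1=g(s-1)$, $p^1_{11}=(s-2)+(g-1)(g-2)$, $p^2_{11}=g(g-1)$. A clique is a set of treatments any two distinct of which are first associates. -}

module Defs where

open import Data.Nat using (ℕ; _+_; _*_; _∸_)
open import Data.Bool using (Bool; true; false; T; _∧_; not; if_then_else_)
open import Data.Fin using (Fin)
open import Data.Fin.Properties using (_≟_)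
open import Data.Fin.Subset using (Subset; _∈_; ∣_∣)
open import Data.Vec using (tabulate)
open import Relation.Nullary using (¬_)
open import Relation.Nullary.Decidable using (⌊_⌋)
open import Relation.Binary.PropositionalEquality using (_≡_; _≢_)

-- The relation of a two-class association scheme on treatments Fin v is given by
-- a Bool-valued function `first`: a pair of DISTINCT treatments x, y are first
-- associates iff first x y = true, second associates iff first x y = false.
-- (The value of first x x is irrelevant.)

assoc : ∀ {v} → (Fin v → Fin v → Bool) → Bool → Fin v → Fin v → Bool
assoc first c x y = not ⌊ x ≟ y ⌋ ∧ (if c then first x y else not (first x y))

count : ∀ {v} → (Fin v → Bool) → ℕ
count P = ∣ tabulate P ∣

record IsAssocScheme2 (v : ℕ) (first : Fin v → Fin v → Bool) : Set where
  field
    symmetric : ∀ x y → first x y ≡ first y x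
    n : Bool → ℕ
    p : Bool → Bool → Bool → ℕ
    n-spec : ∀ i t → count (assoc first i t) ≡ n i
    p-spec : ∀ i j k x y → T (assoc first i x y) →
             count (λ z → assoc first j x z ∧ assoc first k y z) ≡ p i j k

record IsPseudoL (g s : ℕ) (first : Fin (s * s) → Fin (s * s) → Bool) : Set where
  field
    scheme : IsAssocScheme2 (s * s) first
  open IsAssocScheme2 scheme public
  field
    n₁-spec : n true ≡ g * (s ∸ 1)
    p¹₁₁-spec : p true true true ≡ (s ∸ 2) + (g ∸ 1) * (g ∸ 2)
    p²₁₁-spec : p false true true ≡ g * (g ∸ 1)

First : ∀ {v} → (Fin v → Fin v → Bool) → Fin v → Fin v → Set
First first x y = T (assoc first true x y)

firstAssocs : ∀ {v} → (Fin v → Fin v → Bool) → Fin v → Subset v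
firstAssocs first a = tabulate (assoc first true a)

IsClique : ∀ {v} → (Fin v → Fin v → Bool) → Subset v → Set
IsClique first C = ∀ x y → x ∈ C → y ∈ C → x ≢ y → First first x y

module Submission where

-- Write L t i = {t} ∪ A t i for the line through t in direction i; it is an
-- s-clique.  Part (1) is one count: if an s-clique C through t and a ∈ A t i
-- had a point b off L t i, then b ∈ A t j with j ≠ i, and every point of C
-- would be t, one of the g - 2 points of A t i adjacent to b, or one of the at
-- most p¹₁₁ - (s - 2) = (g - 1)(g - 2) common first associates of t and a off
-- A t i; so s ≤ (g - 1)², a contradiction.  Hence C ⊆ L t i, and equal sizes
-- give C = L t i.  So two distinct points lie on at most one line: this gives
-- (2a), and shows that for i₂ ≠ i₁ each trace S j = A t₁ i₂ ∩ A t₂ j has at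
-- most one point.  The traces are disjoint, S j₁ = ∅, and they partition the
-- g - 2 first associates of t₂ on A t₁ i₂; so exactly two are empty, j₁ and
-- one j₂, giving (2b).  Part (2c) is (2b) with t₁ and t₂ exchanged.

open import Defs
open import Data.Nat using (ℕ; zero; suc; pred; _+_; _*_; _∸_; _^_; _≤_; _<_; s≤s; z≤n)
open import Data.Nat.Properties
  using ( +-suc; +-identityʳ; +-cancelˡ-≤; +-monoˡ-≤; +-monoʳ-≤; +-mono-≤; m≤m+n
        ; ≤-reflexive; ≤-trans; <⇒≱; m+[n∸m]≡n; m∸[m∸n]≡n; pred[m∸n]≡m∸[1+n]; module ≤-Reasoning )
open import Data.Nat.Tactic.RingSolver using (solve-∀)
open import Data.Bool using (Bool; true; T; _∧_)
open import Data.Bool.Properties using (T-≡)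
open import Data.Empty using (⊥-elim)
open import Data.Fin using (Fin; zero; suc)
open import Data.Fin.Properties using (suc-injective; _≟_)
open import Data.Fin.Subset
open import Data.Fin.Subset.Properties
open import Data.Vec using ([]; _∷_; tabulate)
open import Data.Vec.Properties using (lookup⇒[]=; []=⇒lookup; lookup∘tabulate)
open import Data.Product using (Σ; _×_; _,_; proj₁; proj₂)
open import Data.Sum as Sum using (_⊎_; inj₁; inj₂)
open import Function using (_∘_; Equivalence)
open import Relation.Nullary using (Dec; yes; no)
open import Relation.Nullary.Decidable using (⌊_⌋; toWitness; fromWitness)
open import Relation.Nullary.Negation using (contradiction)
open import Relation.Binary.PropositionalEquality

private variable n : ℕ

∈-tabulate⁺ : ∀ {P : Fin n → Bool} {x} → T (P x) → x ∈ tabulate P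
∈-tabulate⁺ {P = P} {x} Px =
  lookup⇒[]= x (tabulate P) (trans (lookup∘tabulate P x) (Equivalence.to T-≡ Px))

∈-tabulate⁻ : ∀ {P : Fin n → Bool} {x} → x ∈ tabulate P → T (P x)
∈-tabulate⁻ {P = P} {x} x∈ =
  Equivalence.from T-≡ (trans (sym (lookup∘tabulate P x)) ([]=⇒lookup x∈))

tabulate-∧ : ∀ (P Q : Fin n → Bool) → tabulate (λ x → P x ∧ Q x) ≡ tabulate P ∩ tabulate Q
tabulate-∧ {zero} P Q = refl
tabulate-∧ {suc n} P Q = cong (P zero ∧ Q zero ∷_) (tabulate-∧ (P ∘ suc) (Q ∘ suc))

∣p∪q∣+∣p∩q∣ : ∀ (p q : Subset n) → ∣ p ∪ q ∣ + ∣ p ∩ q ∣ ≡ ∣ p ∣ + ∣ q ∣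
∣p∪q∣+∣p∩q∣ [] [] = refl
∣p∪q∣+∣p∩q∣ (inside ∷ p) (inside ∷ q) =
  cong suc (trans (+-suc _ _) (trans (cong suc (∣p∪q∣+∣p∩q∣ p q)) (sym (+-suc _ _))))
∣p∪q∣+∣p∩q∣ (inside ∷ p) (outside ∷ q) = cong suc (∣p∪q∣+∣p∩q∣ p q)
∣p∪q∣+∣p∩q∣ (outside ∷ p) (inside ∷ q) = trans (cong suc (∣p∪q∣+∣p∩q∣ p q)) (sym (+-suc _ _))
∣p∪q∣+∣p∩q∣ (outside ∷ p) (outside ∷ q) = ∣p∪q∣+∣p∩q∣ p q

∣p∩q∣+∣p∩∁q∣ : ∀ (p q : Subset n) → ∣ p ∩ q ∣ + ∣ p ∩ ∁ q ∣ ≡ ∣ p ∣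
∣p∩q∣+∣p∩∁q∣ [] [] = refl
∣p∩q∣+∣p∩∁q∣ (inside ∷ p) (inside ∷ q) = cong suc (∣p∩q∣+∣p∩∁q∣ p q)
∣p∩q∣+∣p∩∁q∣ (inside ∷ p) (outside ∷ q) = trans (+-suc _ _) (cong suc (∣p∩q∣+∣p∩∁q∣ p q))
∣p∩q∣+∣p∩∁q∣ (outside ∷ p) (_ ∷ q) = ∣p∩q∣+∣p∩∁q∣ p q

∣p∪q∣≤∣p∣+∣q∣ : ∀ (p q : Subset n) → ∣ p ∪ q ∣ ≤ ∣ p ∣ + ∣ q ∣
∣p∪q∣≤∣p∣+∣q∣ p q = ≤-trans (m≤m+n _ _) (≤-reflexive (∣p∪q∣+∣p∩q∣ p q))

∣Empty∣≡0 : ∀ {p : Subset n} → Empty p → ∣ p ∣ ≡ 0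
∣Empty∣≡0 {n} empty = trans (cong ∣_∣ (Empty-unique empty)) (∣⊥∣≡0 n)

disjoint-∣∪∣ : ∀ (p q : Subset n) → Empty (p ∩ q) → ∣ p ∪ q ∣ ≡ ∣ p ∣ + ∣ q ∣
disjoint-∣∪∣ p q apart =
  trans (sym (trans (cong (∣ p ∪ q ∣ +_) (∣Empty∣≡0 apart)) (+-identityʳ _))) (∣p∪q∣+∣p∩q∣ p q)

⊆-card-≡ : ∀ {p q : Subset n} → p ⊆ q → ∣ q ∣ ≤ ∣ p ∣ → p ≡ q
⊆-card-≡ {p = p} {q} p⊆q ∣q∣≤∣p∣ = ⊆-antisym p⊆q q⊆p
  where
  q⊆p : q ⊆ p
  q⊆p {x} x∈q with x ∈? p
  ... | yes x∈p = x∈p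
  ... | no x∉p = contradiction ∣q∣≤∣p∣ (<⇒≱ (p⊂q⇒∣p∣<∣q∣ (p⊆q , x , x∈q , x∉p)))

⁅x⁆⊆p : ∀ {p : Subset n} {x} → x ∈ p → ⁅ x ⁆ ⊆ p
⁅x⁆⊆p {p = p} x∈p y∈⁅x⁆ = subst (_∈ p) (sym (x∈⁅y⁆⇒x≡y _ y∈⁅x⁆)) x∈p

remove-point : ∀ {p : Subset n} {x} → x ∈ p → 1 + ∣ p ∩ ∁ ⁅ x ⁆ ∣ ≡ ∣ p ∣
remove-point {p = p} {x} x∈p = begin
  1 + ∣ p ∩ ∁ ⁅ x ⁆ ∣             ≡⟨ cong (_+ ∣ p ∩ ∁ ⁅ x ⁆ ∣) (sym (∣⁅x⁆∣≡1 x)) ⟩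
  ∣ ⁅ x ⁆ ∣ + ∣ p ∩ ∁ ⁅ x ⁆ ∣     ≡⟨ cong (λ r → ∣ r ∣ + ∣ p ∩ ∁ ⁅ x ⁆ ∣) p∩⁅x⁆≡⁅x⁆ ⟨
  ∣ p ∩ ⁅ x ⁆ ∣ + ∣ p ∩ ∁ ⁅ x ⁆ ∣ ≡⟨ ∣p∩q∣+∣p∩∁q∣ p ⁅ x ⁆ ⟩
  ∣ p ∣                           ∎
  where
  open ≡-Reasoning
  p∩⁅x⁆≡⁅x⁆ : p ∩ ⁅ x ⁆ ≡ ⁅ x ⁆
  p∩⁅x⁆≡⁅x⁆ = ⊆-antisym (p∩q⊆q p ⁅ x ⁆) (λ y∈ → x∈p∩q⁺ (⁅x⁆⊆p x∈p y∈ , y∈))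

AtMostOne : Subset n → Set
AtMostOne p = ∀ {x y} → x ∈ p → y ∈ p → x ≡ y

atMostOne-singleton : ∀ {p : Subset n} {x} → AtMostOne p → x ∈ p → p ≡ ⁅ x ⁆
atMostOne-singleton {x = x} one x∈p =
  ⊆-antisym (λ y∈p → subst (_∈ ⁅ x ⁆) (one x∈p y∈p) (x∈⁅x⁆ x)) (⁅x⁆⊆p x∈p)

∣p∣≡1⇒singleton : ∀ {p : Subset n} → ∣ p ∣ ≡ 1 → Σ (Fin n) λ x → p ≡ ⁅ x ⁆
∣p∣≡1⇒singleton {p = p} ∣p∣≡1 with nonempty? p
... | yes (x , x∈p) =
      x , sym (⊆-card-≡ (⁅x⁆⊆p x∈p) (≤-reflexive (trans ∣p∣≡1 (sym (∣⁅x⁆∣≡1 x)))))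
... | no empty = contradiction (trans (sym (∣Empty∣≡0 empty)) ∣p∣≡1) λ ()

the-other-element : ∀ {p : Subset n} {x} → ∣ p ∣ ≡ 2 → x ∈ p →
  Σ (Fin n) λ y → (y ∈ p × y ≢ x) × (∀ z → z ∈ p → z ≢ x → z ≡ y)
the-other-element {p = p} {x} ∣p∣≡2 x∈p = y , (y∈p , y≢x) , unique
  where
  rest-single : Σ (Fin _) λ y → p ∩ ∁ ⁅ x ⁆ ≡ ⁅ y ⁆
  rest-single = ∣p∣≡1⇒singleton (cong pred (trans (remove-point x∈p) ∣p∣≡2))
  y : Fin _
  y = proj₁ rest-single
  y∈rest : y ∈ p × y ∈ ∁ ⁅ x ⁆
  y∈rest = x∈p∩q⁻ p _ (subst (y ∈_) (sym (proj₂ rest-single)) (x∈⁅x⁆ y))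
  y∈p : y ∈ p
  y∈p = proj₁ y∈rest
  y≢x : y ≢ x
  y≢x = x∉⁅y⁆⇒x≢y (x∈∁p⇒x∉p (proj₂ y∈rest))
  unique : ∀ z → z ∈ p → z ≢ x → z ≡ y
  unique z z∈p z≢x = x∈⁅y⁆⇒x≡y y
    (subst (z ∈_) (proj₂ rest-single) (x∈p∩q⁺ (z∈p , x∉p⇒x∈∁p (x≢y⇒x∉⁅y⁆ z≢x))))

⋃ᶠ : ∀ {k} → (Fin k → Subset n) → Subset n
⋃ᶠ {k = zero} S = ⊥
⋃ᶠ {k = suc k} S = S zero ∪ ⋃ᶠ (S ∘ suc)

∈⋃ᶠ⁺ : ∀ {k} (S : Fin k → Subset n) j {x} → x ∈ S j → x ∈ ⋃ᶠ S
∈⋃ᶠ⁺ S zero x∈ = p⊆p∪q _ x∈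
∈⋃ᶠ⁺ S (suc j) x∈ = q⊆p∪q (S zero) _ (∈⋃ᶠ⁺ (S ∘ suc) j x∈)

∈⋃ᶠ⁻ : ∀ {k} (S : Fin k → Subset n) {x} → x ∈ ⋃ᶠ S → Σ (Fin k) λ j → x ∈ S j
∈⋃ᶠ⁻ {k = zero} S x∈ = contradiction x∈ ∉⊥
∈⋃ᶠ⁻ {k = suc k} S x∈ with x∈p∪q⁻ (S zero) _ x∈
... | inj₁ x∈S₀ = zero , x∈S₀
... | inj₂ x∈rest with ∈⋃ᶠ⁻ (S ∘ suc) x∈rest
...   | j , x∈Sj = suc j , x∈Sj

occupied : ∀ {k} → (Fin k → Subset n) → Subset k
occupied S = tabulate (λ j → ⌊ nonempty? (S j) ⌋)

occupied⁺ : ∀ {k} {S : Fin k → Subset n} {j} → Nonempty (S j) → j ∈ occupied S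
occupied⁺ nonempty = ∈-tabulate⁺ (fromWitness nonempty)

occupied⁻ : ∀ {k} {S : Fin k → Subset n} {j} → j ∈ occupied S → Nonempty (S j)
occupied⁻ j∈ = toWitness (∈-tabulate⁻ j∈)

∈∁occupied⁺ : ∀ {k} {S : Fin k → Subset n} {j} → Empty (S j) → j ∈ ∁ (occupied S)
∈∁occupied⁺ empty = x∉p⇒x∈∁p (empty ∘ occupied⁻)

∈∁occupied⁻ : ∀ {k} {S : Fin k → Subset n} {j} → j ∈ ∁ (occupied S) → Empty (S j)
∈∁occupied⁻ j∈ nonempty = x∈∁p⇒x∉p j∈ (occupied⁺ nonempty)

∣⋃ᶠ∣≡∣occupied∣ : ∀ {k} (S : Fin k → Subset n) → (∀ j → AtMostOne (S j)) →
  (∀ {i j x} → x ∈ S i → x ∈ S j → i ≡ j) → ∣ ⋃ᶠ S ∣ ≡ ∣ occupied S ∣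
∣⋃ᶠ∣≡∣occupied∣ {n} {zero} S one disjoint = ∣⊥∣≡0 n
∣⋃ᶠ∣≡∣occupied∣ {k = suc k} S one disjoint = begin
  ∣ S zero ∪ ⋃ᶠ (S ∘ suc) ∣              ≡⟨ disjoint-∣∪∣ (S zero) _ apart ⟩
  ∣ S zero ∣ + ∣ ⋃ᶠ (S ∘ suc) ∣          ≡⟨ cong (∣ S zero ∣ +_) tail ⟩
  ∣ S zero ∣ + ∣ occupied (S ∘ suc) ∣    ≡⟨ head (nonempty? (S zero)) ⟩
  ∣ occupied S ∣                         ∎
  where
  open ≡-Reasoning
  tail : ∣ ⋃ᶠ (S ∘ suc) ∣ ≡ ∣ occupied (S ∘ suc) ∣
  tail = ∣⋃ᶠ∣≡∣occupied∣ (S ∘ suc) (one ∘ suc) (λ x∈ y∈ → suc-injective (disjoint x∈ y∈))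
  apart : Empty (S zero ∩ ⋃ᶠ (S ∘ suc))
  apart (x , x∈) with x∈p∩q⁻ (S zero) _ x∈
  ... | x∈S₀ , x∈rest with ∈⋃ᶠ⁻ (S ∘ suc) x∈rest
  ...   | j , x∈Sj = contradiction (disjoint x∈S₀ x∈Sj) λ ()
  head : (d : Dec (Nonempty (S zero))) →
         ∣ S zero ∣ + ∣ occupied (S ∘ suc) ∣ ≡ ∣ ⌊ d ⌋ ∷ occupied (S ∘ suc) ∣
  head (yes (x , x∈)) = cong (_+ ∣ occupied (S ∘ suc) ∣)
    (trans (cong ∣_∣ (atMostOne-singleton (one zero) x∈)) (∣⁅x⁆∣≡1 x))
  head (no empty) = cong (_+ ∣ occupied (S ∘ suc) ∣) (∣Empty∣≡0 empty)

-- The bound 1 + (g - 2) + (g - 1)(g - 2) on an s-clique leaving a line.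
square-identity : ∀ g → 2 ≤ g → 1 + ((g ∸ 2) + (g ∸ 1) * (g ∸ 2)) ≡ (g ∸ 1) ^ 2
square-identity (suc (suc k)) (s≤s (s≤s z≤n)) = polynomial k
  where
  polynomial : ∀ k → 1 + (k + (1 + k) * k) ≡ (1 + k) * ((1 + k) * 1)
  polynomial = solve-∀

module Associates {v : ℕ} (first : Fin v → Fin v → Bool)
                  (symmetric : ∀ x y → first x y ≡ first y x) where

  First⇒≢ : ∀ {x y} → First first x y → x ≢ y
  First⇒≢ {x} {y} x~y with x ≟ y
  ... | yes _ = ⊥-elim x~y
  ... | no x≢y = x≢y

  First-sym : ∀ {x y} → First first x y → First first y x
  First-sym {x} {y} x~y with x ≟ y | y ≟ x
  ... | yes _ | _ = ⊥-elim x~y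
  ... | no x≢y | yes y≡x = contradiction (sym y≡x) x≢y
  ... | no _ | no _ = subst T (symmetric x y) x~y

module Lines
  (g s : ℕ) (g≥3 : 3 ≤ g) (g≤s : g ≤ s) (small : (g ∸ 1) ^ 2 < s)
  (first : Fin (s * s) → Fin (s * s) → Bool) (pseudoL : IsPseudoL g s first)
  (A : Fin (s * s) → Fin g → Subset (s * s))
  (A-disjoint : ∀ t i j x → x ∈ A t i → x ∈ A t j → i ≡ j)
  (A-size : ∀ t i → ∣ A t i ∣ ≡ s ∸ 1)
  (A-cover : ∀ t x → First first t x → Σ (Fin g) (λ i → x ∈ A t i))
  (A-first : ∀ t i x → x ∈ A t i → First first t x)
  (line-clique : ∀ t i → IsClique first (⁅ t ⁆ ∪ A t i))
  (A-meets : ∀ t i a → a ∈ A t i → ∀ j → j ≢ i → ∣ A t j ∩ firstAssocs first a ∣ ≡ g ∸ 2)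
  where

  open IsPseudoL pseudoL using (symmetric; p-spec; p¹₁₁-spec)
  open Associates first symmetric

  V : Set
  V = Fin (s * s)

  N : V → Subset (s * s)
  N = firstAssocs first

  L : V → Fin g → Subset (s * s)
  L t i = ⁅ t ⁆ ∪ A t i

  g≥2 : 2 ≤ g
  g≥2 = ≤-trans (s≤s (s≤s z≤n)) g≥3

  t∈L : ∀ t i → t ∈ L t i
  t∈L t i = p⊆p∪q (A t i) (x∈⁅x⁆ t)

  A⊆L : ∀ {t i} → A t i ⊆ L t i
  A⊆L {t} = q⊆p∪q ⁅ t ⁆ _

  L-cases : ∀ {t i x} → x ∈ L t i → x ≡ t ⊎ x ∈ A t i
  L-cases {t} {i} x∈ = Sum.map₁ (x∈⁅y⁆⇒x≡y t) (x∈p∪q⁻ ⁅ t ⁆ (A t i) x∈)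

  t∉A : ∀ t i → t ∉ A t i
  t∉A t i t∈A = First⇒≢ (A-first t i t t∈A) refl

  line-size : ∀ t i → ∣ L t i ∣ ≡ s
  line-size t i = begin
    ∣ ⁅ t ⁆ ∪ A t i ∣       ≡⟨ disjoint-∣∪∣ ⁅ t ⁆ (A t i) apart ⟩
    ∣ ⁅ t ⁆ ∣ + ∣ A t i ∣   ≡⟨ cong₂ _+_ (∣⁅x⁆∣≡1 t) (A-size t i) ⟩
    1 + (s ∸ 1)             ≡⟨ m+[n∸m]≡n (≤-trans (s≤s z≤n) (≤-trans g≥3 g≤s)) ⟩
    s                       ∎
    where
    open ≡-Reasoning
    apart : Empty (⁅ t ⁆ ∩ A t i)
    apart (x , x∈) with x∈p∩q⁻ ⁅ t ⁆ (A t i) x∈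
    ... | x∈⁅t⁆ , x∈A = t∉A t i (subst (_∈ A t i) (x∈⁅y⁆⇒x≡y t x∈⁅t⁆) x∈A)

  common-count : ∀ {t a} → First first t a → ∣ N t ∩ N a ∣ ≡ (s ∸ 2) + (g ∸ 1) * (g ∸ 2)
  common-count {t} {a} t~a = begin
    ∣ N t ∩ N a ∣
      ≡⟨ cong ∣_∣ (tabulate-∧ (assoc first true t) (assoc first true a)) ⟨
    count (λ z → assoc first true t z ∧ assoc first true a z)
      ≡⟨ p-spec true true true t a t~a ⟩
    IsPseudoL.p pseudoL true true true
      ≡⟨ p¹₁₁-spec ⟩
    (s ∸ 2) + (g ∸ 1) * (g ∸ 2) ∎
    where open ≡-Reasoning

  -- The s - 2 other points of the line of a are common first associates of
  -- t and a, so at most (g - 1)(g - 2) common first associates lie off it.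
  off-line-bound : ∀ t i a → a ∈ A t i → ∣ (N t ∩ N a) ∩ ∁ (A t i) ∣ ≤ (g ∸ 1) * (g ∸ 2)
  off-line-bound t i a a∈A = +-cancelˡ-≤ (s ∸ 2) _ _ (begin
    (s ∸ 2) + ∣ M ∩ ∁ (A t i) ∣           ≤⟨ +-monoˡ-≤ _ on-line ⟩
    ∣ M ∩ A t i ∣ + ∣ M ∩ ∁ (A t i) ∣     ≡⟨ ∣p∩q∣+∣p∩∁q∣ M (A t i) ⟩
    ∣ M ∣                                 ≡⟨ common-count (A-first t i a a∈A) ⟩
    (s ∸ 2) + (g ∸ 1) * (g ∸ 2)           ∎)
    where
    open ≤-Reasoning
    M : Subset (s * s)
    M = N t ∩ N a
    others-on-line : A t i ∩ ∁ ⁅ a ⁆ ⊆ M ∩ A t i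
    others-on-line {y} y∈ with x∈p∩q⁻ (A t i) _ y∈
    ... | y∈A , y∉⁅a⁆ = x∈p∩q⁺ (x∈p∩q⁺ (∈-tabulate⁺ (A-first t i y y∈A) , ∈-tabulate⁺ a~y) , y∈A)
      where
      a~y : First first a y
      a~y = line-clique t i a y (A⊆L a∈A) (A⊆L y∈A) (x∉⁅y⁆⇒x≢y (x∈∁p⇒x∉p y∉⁅a⁆) ∘ sym)
    on-line : s ∸ 2 ≤ ∣ M ∩ A t i ∣
    on-line = begin
      s ∸ 2                  ≡⟨ pred[m∸n]≡m∸[1+n] s 1 ⟨
      pred (s ∸ 1)           ≡⟨ cong pred (trans (sym (A-size t i)) (sym (remove-point a∈A))) ⟩
      ∣ A t i ∩ ∁ ⁅ a ⁆ ∣    ≤⟨ p⊆q⇒∣p∣≤∣q∣ others-on-line ⟩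
      ∣ M ∩ A t i ∣          ∎

  outsider-bound : ∀ t i a → a ∈ A t i → ∀ C → IsClique first C → t ∈ C → a ∈ C →
                   ∀ b → b ∈ C → b ∉ L t i → ∣ C ∣ ≤ (g ∸ 1) ^ 2
  outsider-bound t i a a∈A C C-clique t∈C a∈C b b∈C b∉L = begin
    ∣ C ∣                                  ≤⟨ p⊆q⇒∣p∣≤∣q∣ C-covered ⟩
    ∣ ⁅ t ⁆ ∪ (A t i ∩ N b ∪ R) ∣          ≤⟨ ∣p∪q∣≤∣p∣+∣q∣ ⁅ t ⁆ _ ⟩
    ∣ ⁅ t ⁆ ∣ + ∣ A t i ∩ N b ∪ R ∣
      ≤⟨ +-mono-≤ (≤-reflexive (∣⁅x⁆∣≡1 t)) (∣p∪q∣≤∣p∣+∣q∣ (A t i ∩ N b) R) ⟩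
    1 + (∣ A t i ∩ N b ∣ + ∣ R ∣)
      ≤⟨ +-monoʳ-≤ 1 (+-mono-≤ (≤-reflexive b-meets-line) (off-line-bound t i a a∈A)) ⟩
    1 + ((g ∸ 2) + (g ∸ 1) * (g ∸ 2))      ≡⟨ square-identity g g≥2 ⟩
    (g ∸ 1) ^ 2                            ∎
    where
    open ≤-Reasoning
    R : Subset (s * s)
    R = (N t ∩ N a) ∩ ∁ (A t i)
    b∉A : b ∉ A t i
    b∉A = b∉L ∘ A⊆L
    t~b : First first t b
    t~b = C-clique t b t∈C b∈C (λ t≡b → b∉L (subst (_∈ L t i) t≡b (t∈L t i)))
    b-meets-line : ∣ A t i ∩ N b ∣ ≡ g ∸ 2
    b-meets-line with A-cover t b t~b
    ... | j , b∈Aj = A-meets t j b b∈Aj i (λ i≡j → b∉A (subst (λ k → b ∈ A t k) (sym i≡j) b∈Aj))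
    C-covered : C ⊆ ⁅ t ⁆ ∪ (A t i ∩ N b ∪ R)
    C-covered {y} y∈C with y ≟ t | y ∈? A t i
    ... | yes y≡t | _ = p⊆p∪q _ (subst (_∈ ⁅ t ⁆) (sym y≡t) (x∈⁅x⁆ t))
    ... | no y≢t | yes y∈A = q⊆p∪q ⁅ t ⁆ _ (p⊆p∪q R (x∈p∩q⁺ (y∈A , ∈-tabulate⁺
          (C-clique b y b∈C y∈C (λ b≡y → b∉A (subst (_∈ A t i) (sym b≡y) y∈A))))))
    ... | no y≢t | no y∉A = q⊆p∪q ⁅ t ⁆ _ (q⊆p∪q (A t i ∩ N b) R (x∈p∩q⁺ (x∈p∩q⁺
          ( ∈-tabulate⁺ (C-clique t y t∈C y∈C (y≢t ∘ sym))
          , ∈-tabulate⁺ (C-clique a y a∈C y∈C (λ a≡y → y∉A (subst (_∈ A t i) a≡y a∈A))))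
          , x∉p⇒x∈∁p y∉A)))

  unique-clique : ∀ t i a → a ∈ A t i → ∀ C → IsClique first C → ∣ C ∣ ≡ s → t ∈ C → a ∈ C →
                  C ≡ L t i
  unique-clique t i a a∈A C C-clique ∣C∣≡s t∈C a∈C =
    ⊆-card-≡ C⊆L (≤-reflexive (trans (line-size t i) (sym ∣C∣≡s)))
    where
    C⊆L : C ⊆ L t i
    C⊆L {b} b∈C with b ∈? L t i
    ... | yes b∈L = b∈L
    ... | no b∉L = contradiction (subst (_≤ (g ∸ 1) ^ 2) ∣C∣≡s
                     (outsider-bound t i a a∈A C C-clique t∈C a∈C b b∈C b∉L)) (<⇒≱ small)

  -- Two lines sharing two distinct points coincide: both are the line
  -- through the first point in the direction of the second.
  lines-through-two-points : ∀ {t i t′ i′ x y} → x ≢ y → x ∈ L t i → y ∈ L t i →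
                             x ∈ L t′ i′ → y ∈ L t′ i′ → L t i ≡ L t′ i′
  lines-through-two-points {t} {i} {t′} {i′} {x} {y} x≢y x∈L y∈L x∈L′ y∈L′ =
    trans (line-of-xy t i x∈L y∈L) (sym (line-of-xy t′ i′ x∈L′ y∈L′))
    where
    direction : Σ (Fin g) λ k → y ∈ A x k
    direction = A-cover x y (line-clique t i x y x∈L y∈L x≢y)
    line-of-xy : ∀ u j → x ∈ L u j → y ∈ L u j → L u j ≡ L x (proj₁ direction)
    line-of-xy u j x∈ y∈ =
      unique-clique x (proj₁ direction) y (proj₂ direction) (L u j) (line-clique u j) (line-size u j) x∈ y∈

  common-line : ∀ {t₁ t₂ i₁ j₁} → t₂ ∈ A t₁ i₁ → t₁ ∈ A t₂ j₁ → L t₁ i₁ ≡ L t₂ j₁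
  common-line {t₁} {t₂} {i₁} {j₁} t₂∈A t₁∈A = sym (unique-clique t₁ i₁ t₂ t₂∈A (L t₂ j₁)
    (line-clique t₂ j₁) (line-size t₂ j₁) (A⊆L t₁∈A) (t∈L t₂ j₁))

  module Crossing {t₁ t₂ : V} (t₁~t₂ : First first t₁ t₂) {i₁ j₁ : Fin g}
                  (t₂∈A : t₂ ∈ A t₁ i₁) (t₁∈A : t₁ ∈ A t₂ j₁) {i₂ : Fin g} (i₂≢i₁ : i₂ ≢ i₁) where

    S : Fin g → Subset (s * s)
    S j = A t₁ i₂ ∩ A t₂ j

    meet : ∀ {j} → j ≢ j₁ → L t₁ i₂ ∩ L t₂ j ≡ S j
    meet {j} j≢j₁ = ⊆-antisym meet⊆S S⊆meet
      where
      S⊆meet : S j ⊆ L t₁ i₂ ∩ L t₂ j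
      S⊆meet y∈ with x∈p∩q⁻ (A t₁ i₂) _ y∈
      ... | y∈A₁ , y∈A₂ = x∈p∩q⁺ (A⊆L y∈A₁ , A⊆L y∈A₂)
      meet⊆S : L t₁ i₂ ∩ L t₂ j ⊆ S j
      meet⊆S {y} y∈ with x∈p∩q⁻ (L t₁ i₂) _ y∈
      ... | y∈L₁ , y∈L₂ with L-cases y∈L₁ | L-cases y∈L₂
      ... | inj₁ y≡t₁ | inj₁ y≡t₂ = contradiction (trans (sym y≡t₁) y≡t₂) (First⇒≢ t₁~t₂)
      ... | inj₁ y≡t₁ | inj₂ y∈A₂ =
            contradiction (A-disjoint t₂ j j₁ t₁ (subst (_∈ A t₂ j) y≡t₁ y∈A₂) t₁∈A) j≢j₁
      ... | inj₂ y∈A₁ | inj₁ y≡t₂ =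
            contradiction (A-disjoint t₁ i₂ i₁ t₂ (subst (_∈ A t₁ i₂) y≡t₂ y∈A₁) t₂∈A) i₂≢i₁
      ... | inj₂ y∈A₁ | inj₂ y∈A₂ = x∈p∩q⁺ (y∈A₁ , y∈A₂)

    -- A t₂ j₁ lies on the common line L t₁ i₁, which A t₁ i₂ avoids.
    S-j₁-empty : Empty (S j₁)
    S-j₁-empty (y , y∈) with x∈p∩q⁻ (A t₁ i₂) _ y∈
    ... | y∈A₁ , y∈A₂ with L-cases (subst (y ∈_) (sym (common-line t₂∈A t₁∈A)) (A⊆L y∈A₂))
    ...   | inj₁ y≡t₁ = t∉A t₁ i₂ (subst (_∈ A t₁ i₂) y≡t₁ y∈A₁)
    ...   | inj₂ y∈A₁₁ = i₂≢i₁ (A-disjoint t₁ i₂ i₁ y y∈A₁ y∈A₁₁)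

    S-disjoint : ∀ {j j′ x} → x ∈ S j → x ∈ S j′ → j ≡ j′
    S-disjoint {j} {j′} {x} x∈ x∈′ =
      A-disjoint t₂ j j′ x (proj₂ (x∈p∩q⁻ (A t₁ i₂) _ x∈)) (proj₂ (x∈p∩q⁻ (A t₁ i₂) _ x∈′))

    -- Two points of S j would force L t₁ i₂ = L t₂ j, putting t₁ into A t₂ j;
    -- then j = j₁, and S j₁ is empty.
    S-atMostOne : ∀ j → AtMostOne (S j)
    S-atMostOne j {x} {y} x∈ y∈ with x ≟ y
    ... | yes x≡y = x≡y
    ... | no x≢y with L-cases (subst (t₁ ∈_) same-line (t∈L t₁ i₂))
      where
      x∈S : x ∈ A t₁ i₂ × x ∈ A t₂ j
      x∈S = x∈p∩q⁻ (A t₁ i₂) _ x∈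
      y∈S : y ∈ A t₁ i₂ × y ∈ A t₂ j
      y∈S = x∈p∩q⁻ (A t₁ i₂) _ y∈
      same-line : L t₁ i₂ ≡ L t₂ j
      same-line = lines-through-two-points x≢y (A⊆L (proj₁ x∈S)) (A⊆L (proj₁ y∈S))
                                               (A⊆L (proj₂ x∈S)) (A⊆L (proj₂ y∈S))
    ...   | inj₁ t₁≡t₂ = contradiction t₁≡t₂ (First⇒≢ t₁~t₂)
    ...   | inj₂ t₁∈Aj =
            ⊥-elim (S-j₁-empty (x , subst (λ k → x ∈ S k) (A-disjoint t₂ j j₁ t₁ t₁∈Aj t₁∈A) x∈))

    ⋃S : ⋃ᶠ S ≡ A t₁ i₂ ∩ N t₂
    ⋃S = ⊆-antisym ⋃S⊆ ⊆⋃S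
      where
      ⋃S⊆ : ⋃ᶠ S ⊆ A t₁ i₂ ∩ N t₂
      ⋃S⊆ y∈ with ∈⋃ᶠ⁻ S y∈
      ... | j , y∈Sj with x∈p∩q⁻ (A t₁ i₂) _ y∈Sj
      ...   | y∈A₁ , y∈A₂ = x∈p∩q⁺ (y∈A₁ , ∈-tabulate⁺ (A-first t₂ j _ y∈A₂))
      ⊆⋃S : A t₁ i₂ ∩ N t₂ ⊆ ⋃ᶠ S
      ⊆⋃S {y} y∈ with x∈p∩q⁻ (A t₁ i₂) _ y∈
      ... | y∈A₁ , y∈N with A-cover t₂ y (∈-tabulate⁻ y∈N)
      ...   | j , y∈A₂ = ∈⋃ᶠ⁺ S j (x∈p∩q⁺ (y∈A₁ , y∈A₂))

    Z : Subset g
    Z = ∁ (occupied S)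

    -- g - 2 of the g traces are single points, so exactly two are empty.
    ∣Z∣≡2 : ∣ Z ∣ ≡ 2
    ∣Z∣≡2 = begin
      ∣ ∁ (occupied S) ∣       ≡⟨ ∣∁p∣≡n∸∣p∣ (occupied S) ⟩
      g ∸ ∣ occupied S ∣       ≡⟨ cong (g ∸_) (∣⋃ᶠ∣≡∣occupied∣ S S-atMostOne S-disjoint) ⟨
      g ∸ ∣ ⋃ᶠ S ∣             ≡⟨ cong (λ p → g ∸ ∣ p ∣) ⋃S ⟩
      g ∸ ∣ A t₁ i₂ ∩ N t₂ ∣   ≡⟨ cong (g ∸_) (A-meets t₁ i₁ t₂ t₂∈A i₂ i₂≢i₁) ⟩
      g ∸ (g ∸ 2)              ≡⟨ m∸[m∸n]≡n g≥2 ⟩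
      2                        ∎
      where open ≡-Reasoning

    other-empty : Σ (Fin g) λ j₂ → (j₂ ∈ Z × j₂ ≢ j₁) × (∀ j → j ∈ Z → j ≢ j₁ → j ≡ j₂)
    other-empty = the-other-element ∣Z∣≡2 (∈∁occupied⁺ {S = S} S-j₁-empty)

    j₂ : Fin g
    j₂ = proj₁ other-empty

    j₂∈Z : j₂ ∈ Z
    j₂∈Z = proj₁ (proj₁ (proj₂ other-empty))

    j₂≢j₁ : j₂ ≢ j₁
    j₂≢j₁ = proj₂ (proj₁ (proj₂ other-empty))

    Z-unique : ∀ j → j ∈ Z → j ≢ j₁ → j ≡ j₂
    Z-unique = proj₂ (proj₂ other-empty)

    crossing : Σ (Fin g) λ j₂ →
        (j₂ ≢ j₁ × Empty (L t₁ i₂ ∩ L t₂ j₂))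
        × (∀ j → j ≢ j₁ → Empty (L t₁ i₂ ∩ L t₂ j) → j ≡ j₂)
        × (∀ j′ → j′ ≢ j₁ → j′ ≢ j₂ → Σ V λ x →
            (L t₁ i₂ ∩ L t₂ j′ ≡ ⁅ x ⁆) × First first t₁ x × First first t₂ x)
    crossing =
      j₂ , (j₂≢j₁ , subst Empty (sym (meet j₂≢j₁)) (∈∁occupied⁻ {S = S} j₂∈Z)) , empty-is-j₂ , single-point
      where
      empty-is-j₂ : ∀ j → j ≢ j₁ → Empty (L t₁ i₂ ∩ L t₂ j) → j ≡ j₂
      empty-is-j₂ j j≢j₁ empty = Z-unique j (∈∁occupied⁺ {S = S} (subst Empty (meet j≢j₁) empty)) j≢j₁
      single-point : ∀ j′ → j′ ≢ j₁ → j′ ≢ j₂ → Σ V λ x →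
            (L t₁ i₂ ∩ L t₂ j′ ≡ ⁅ x ⁆) × First first t₁ x × First first t₂ x
      single-point j′ j′≢j₁ j′≢j₂ =
        x , trans (meet j′≢j₁) (atMostOne-singleton (S-atMostOne j′) x∈S)
          , A-first t₁ i₂ x (proj₁ (x∈p∩q⁻ (A t₁ i₂) _ x∈S))
          , A-first t₂ j′ x (proj₂ (x∈p∩q⁻ (A t₁ i₂) _ x∈S))
        where
        j′∉Z : j′ ∉ Z
        j′∉Z j′∈Z = j′≢j₂ (Z-unique j′ j′∈Z j′≢j₁)
        x : V
        x = proj₁ (occupied⁻ {S = S} (x∉∁p⇒x∈p j′∉Z))
        x∈S : x ∈ S j′
        x∈S = proj₂ (occupied⁻ {S = S} (x∉∁p⇒x∈p j′∉Z))

  crossing-dual : ∀ {t₁ t₂} → First first t₁ t₂ → ∀ {i₁ j₁} → t₂ ∈ A t₁ i₁ → t₁ ∈ A t₂ j₁ →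
    ∀ {j₃} → j₃ ≢ j₁ → Σ (Fin g) λ i₃ →
        (i₃ ≢ i₁ × Empty (L t₂ j₃ ∩ L t₁ i₃))
        × (∀ i → i ≢ i₁ → Empty (L t₂ j₃ ∩ L t₁ i) → i ≡ i₃)
        × (∀ i′ → i′ ≢ i₁ → i′ ≢ i₃ → Σ V λ x →
            (L t₂ j₃ ∩ L t₁ i′ ≡ ⁅ x ⁆) × First first t₁ x × First first t₂ x)
  crossing-dual t₁~t₂ t₂∈A t₁∈A j₃≢j₁ with Crossing.crossing (First-sym t₁~t₂) t₁∈A t₂∈A j₃≢j₁
  ... | i₃ , empty , unique , single = i₃ , empty , unique , λ i′ i′≢i₁ i′≢i₃ →
        let (x , meet , t₂~x , t₁~x) = single i′ i′≢i₁ i′≢i₃ in x , meet , t₁~x , t₂~x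

theorem3p6 : (g s : ℕ) → 3 ≤ g → g ≤ s → (g ∸ 1) ^ 2 < s →
  (first : Fin (s * s) → Fin (s * s) → Bool) → IsPseudoL g s first →
  (A : Fin (s * s) → Fin g → Subset (s * s)) →
  (∀ t i j x → x ∈ A t i → x ∈ A t j → i ≡ j) →
  (∀ t i → ∣ A t i ∣ ≡ s ∸ 1) →
  (∀ t x → First first t x → Σ (Fin g) (λ i → x ∈ A t i)) →
  (∀ t i x → x ∈ A t i → First first t x) →
  (∀ t i → IsClique first (⁅ t ⁆ ∪ A t i)) →
  (∀ t i a → a ∈ A t i → ∀ j → j ≢ i → ∣ A t j ∩ firstAssocs first a ∣ ≡ g ∸ 2) →
  -- (1)
  (∀ t i a → a ∈ A t i → ∀ C → IsClique first C → ∣ C ∣ ≡ s → t ∈ C → a ∈ C →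
     C ≡ ⁅ t ⁆ ∪ A t i)
  ×
  -- (2)
  (∀ t₁ t₂ → First first t₁ t₂ → ∀ i₁ j₁ → t₂ ∈ A t₁ i₁ → t₁ ∈ A t₂ j₁ →
    -- (a)
    ((⁅ t₁ ⁆ ∪ A t₁ i₁ ≡ ⁅ t₂ ⁆ ∪ A t₂ j₁)
      × IsClique first (⁅ t₁ ⁆ ∪ A t₁ i₁)
      × ∣ ⁅ t₁ ⁆ ∪ A t₁ i₁ ∣ ≡ s
      × (∀ C → IsClique first C → ∣ C ∣ ≡ s → t₁ ∈ C → t₂ ∈ C → C ≡ ⁅ t₁ ⁆ ∪ A t₁ i₁))
    ×
    -- (b)
    (∀ i₂ → i₂ ≢ i₁ → Σ (Fin g) λ j₂ →
      (j₂ ≢ j₁ × Empty ((⁅ t₁ ⁆ ∪ A t₁ i₂) ∩ (⁅ t₂ ⁆ ∪ A t₂ j₂)))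
      × (∀ j → j ≢ j₁ → Empty ((⁅ t₁ ⁆ ∪ A t₁ i₂) ∩ (⁅ t₂ ⁆ ∪ A t₂ j)) → j ≡ j₂)
      × (∀ j′ → j′ ≢ j₁ → j′ ≢ j₂ → Σ (Fin (s * s)) λ x →
          ((⁅ t₁ ⁆ ∪ A t₁ i₂) ∩ (⁅ t₂ ⁆ ∪ A t₂ j′) ≡ ⁅ x ⁆)
          × First first t₁ x × First first t₂ x))
    ×
    -- (c)
    (∀ j₃ → j₃ ≢ j₁ → Σ (Fin g) λ i₃ →
      (i₃ ≢ i₁ × Empty ((⁅ t₂ ⁆ ∪ A t₂ j₃) ∩ (⁅ t₁ ⁆ ∪ A t₁ i₃)))
      × (∀ i → i ≢ i₁ → Empty ((⁅ t₂ ⁆ ∪ A t₂ j₃) ∩ (⁅ t₁ ⁆ ∪ A t₁ i)) → i ≡ i₃)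
      × (∀ i′ → i′ ≢ i₁ → i′ ≢ i₃ → Σ (Fin (s * s)) λ x →
          ((⁅ t₂ ⁆ ∪ A t₂ j₃) ∩ (⁅ t₁ ⁆ ∪ A t₁ i′) ≡ ⁅ x ⁆)
          × First first t₁ x × First first t₂ x)))
theorem3p6 g s g≥3 g≤s small first pseudoL A A-disjoint A-size A-cover A-first line-clique A-meets =
  unique-clique , λ t₁ t₂ t₁~t₂ i₁ j₁ t₂∈A t₁∈A →
    ( common-line t₂∈A t₁∈A , line-clique t₁ i₁ , line-size t₁ i₁
    , λ C C-clique ∣C∣≡s t₁∈C t₂∈C → unique-clique t₁ i₁ t₂ t₂∈A C C-clique ∣C∣≡s t₁∈C t₂∈C )
    , (λ i₂ i₂≢i₁ → Crossing.crossing t₁~t₂ t₂∈A t₁∈A i₂≢i₁)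
    , (λ j₃ j₃≢j₁ → crossing-dual t₁~t₂ t₂∈A t₁∈A j₃≢j₁)
  where
  open Lines g s g≥3 g≤s small first pseudoL A A-disjoint A-size A-cover A-first line-clique A-meets
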